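{- Let $n,m,m'$ be positive integers with $n>m$, $n>m'$ and $m\neq m'$. Then the distinguishing number of $K_{n,m}+K_{n,m'}$ is $n+1$.
   Context: $K_{a,b}$ is the complete bipartite graph with parts of sizes $a$ and $b$. The join $G_1+G_2$ of graphs on disjoint vertex sets has as edges all edges of $G_1$, all edges of $G_2$, and all pairs with one end in each. The distinguishing number $D(G)$ is the least $r$ such that there is a labeling $V(G)\to\{1,\ldots,r\}$ preserved by no non-identity automorphism of $G$. -}

module Defs where

open import Data.Nat using (ℕ; _≤_)
open import Data.Fin using (Fin)
open import Data.Bool using (Bool; true; false; _∨_)
open import Data.Sum using (_⊎_; inj₁; inj₂)
open import Data.Product using (Σ; _×_; ∃)
open import Function.Bundles using (_↔_; Inverse)
open import Relation.Binary.PropositionalEquality using (_≡_)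

record Graph (V : Set) : Set where
  field
    adj   : V → V → Bool
    sym   : ∀ x y → adj x y ≡ adj y x
    irrefl : ∀ x → adj x x ≡ false
open Graph public

K-adj : (a b : ℕ) → (Fin a ⊎ Fin b) → (Fin a ⊎ Fin b) → Bool
K-adj a b (inj₁ _) (inj₁ _) = false
K-adj a b (inj₁ _) (inj₂ _) = true
K-adj a b (inj₂ _) (inj₁ _) = true
K-adj a b (inj₂ _) (inj₂ _) = false

K : (a b : ℕ) → Graph (Fin a ⊎ Fin b)
K a b = record { adj = K-adj a b ; sym = s ; irrefl = i }
  where
  s : ∀ x y → K-adj a b x y ≡ K-adj a b y x
  s (inj₁ _) (inj₁ _) = Relation.Binary.PropositionalEquality.refl
  s (inj₁ _) (inj₂ _) = Relation.Binary.PropositionalEquality.refl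
  s (inj₂ _) (inj₁ _) = Relation.Binary.PropositionalEquality.refl
  s (inj₂ _) (inj₂ _) = Relation.Binary.PropositionalEquality.refl
  i : ∀ x → K-adj a b x x ≡ false
  i (inj₁ _) = Relation.Binary.PropositionalEquality.refl
  i (inj₂ _) = Relation.Binary.PropositionalEquality.refl

join-adj : {V W : Set} → Graph V → Graph W → (V ⊎ W) → (V ⊎ W) → Bool
join-adj G H (inj₁ x) (inj₁ y) = adj G x y
join-adj G H (inj₁ _) (inj₂ _) = true
join-adj G H (inj₂ _) (inj₁ _) = true
join-adj G H (inj₂ x) (inj₂ y) = adj H x y

_+ᴳ_ : {V W : Set} → Graph V → Graph W → Graph (V ⊎ W)
_+ᴳ_ {V} {W} G H = record { adj = join-adj G H ; sym = s ; irrefl = i }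
  where
  s : ∀ x y → join-adj G H x y ≡ join-adj G H y x
  s (inj₁ x) (inj₁ y) = sym G x y
  s (inj₁ _) (inj₂ _) = Relation.Binary.PropositionalEquality.refl
  s (inj₂ _) (inj₁ _) = Relation.Binary.PropositionalEquality.refl
  s (inj₂ x) (inj₂ y) = sym H x y
  i : ∀ x → join-adj G H x x ≡ false
  i (inj₁ x) = irrefl G x
  i (inj₂ x) = irrefl H x

-- An automorphism: a bijection of the vertex set preserving adjacency
-- (and non-adjacency, since adjacency is Bool-valued).
record Automorphism {V : Set} (G : Graph V) : Set where
  field
    perm     : V ↔ V
    preserves : ∀ x y → adj G (Inverse.to perm x) (Inverse.to perm y) ≡ adj G x y
open Automorphism public

IsDistinguishing : {V : Set} (G : Graph V) (r : ℕ) → (V → Fin r) → Set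
IsDistinguishing {V} G r ℓ =
  (σ : Automorphism G) →
  (∀ x → ℓ (Inverse.to (perm σ) x) ≡ ℓ x) →
  ∀ x → Inverse.to (perm σ) x ≡ x

Distinguishable : {V : Set} (G : Graph V) (r : ℕ) → Set
Distinguishable {V} G r = Σ (V → Fin r) (IsDistinguishing G r)

DistinguishingNumber : {V : Set} (G : Graph V) (d : ℕ) → Set
DistinguishingNumber G d = Distinguishable G d × (∀ r → Distinguishable G r → d ≤ r)

-- Write A, B, C, D for the parts of sizes n, m, n, m′ of K_{n,m} + K_{n,m′}; two vertices
-- are non-adjacent exactly when they lie in the same part.  A distinguishing labelling restricts
-- to distinguishing labellings of the summands, so it is injective on A and on C; with at most
-- n labels both are bijections onto the labels, and exchanging A and C along them is a
-- label-preserving automorphism, so at least n + 1 labels are needed.  Conversely label A by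
-- 0, …, n − 1 and B, C, D by 1, 2, … .  An automorphism maps parts to parts, and one preserving labels fixes
-- A (the only label 0) and C (the only label n), so it permutes B and D; exchanging them would
-- force m ≤ m′ ≤ m through the largest labels of B and D.  Since labels within a part are
-- distinct, every vertex is fixed.
module Submission where

open import Defs hiding (sym)
open import Data.Nat using (ℕ; suc; _<_; _>_)
open import Relation.Binary.PropositionalEquality using (_≢_)

open import Data.Bool using (Bool; true; false)
open import Data.Empty using (⊥-elim)
open import Data.Fin using (Fin; zero; suc; toℕ; fromℕ; fromℕ<; punchOut)
open import Data.Fin.Permutation using (Permutation; permutation; transpose; _⟨$⟩ʳ_; _⟨$⟩ˡ_; inverseʳ; inverseˡ)
import Data.Fin.Permutation.Components as PC
open import Data.Fin.Properties using (_≟_; toℕ-injective; toℕ<n; toℕ-fromℕ; toℕ-fromℕ<; any?; injective⇒≤; punchOut-injective)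
open import Data.Nat using (_≤_; z≤n; s≤s; s≤s⁻¹)
open import Data.Nat.Properties using (suc-injective; <⇒≤; <-≤-trans; <-irrefl; ≤-antisym; ≰⇒>; <⇒≱)
open import Data.Product using (Σ; ∃; _×_; _,_; proj₁; proj₂)
open import Data.Sum using (_⊎_; inj₁; inj₂; [_,_]; map)
open import Data.Sum.Properties using (inj₁-injective; inj₂-injective)
open import Data.Sum.Function.Propositional using (_⊎-↔_)
open import Data.Unit using (⊤; tt)
open import Function using (_∘_; id; const; _↔_; Inverse; Injection; mk↔ₛ′)
open import Function.Definitions using (Injective)
open import Function.Properties.Inverse using (↔-refl; ↔⇒↣)
open import Relation.Binary.PropositionalEquality using (_≡_; refl; sym; trans; cong; subst; module ≡-Reasoning)
open import Relation.Nullary using (¬_; yes; no; contradiction)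

act : {V : Set} {G : Graph V} → Automorphism G → V → V
act σ = Inverse.to (perm σ)

transpose-matchˡ : ∀ {n} (i j : Fin n) → PC.transpose i j i ≡ j
transpose-matchˡ i j with i ≟ i
... | yes _ = refl
... | no i≢i = contradiction refl i≢i

transpose-respects : ∀ {n} {X : Set} (f : Fin n → X) {i j : Fin n} → f i ≡ f j →
                     ∀ k → f (PC.transpose i j k) ≡ f k
transpose-respects f {i} {j} fi≡fj k with k ≟ i
... | yes refl = sym fi≡fj
... | no _ with k ≟ j
...   | yes refl = fi≡fj
...   | no _ = refl

injective⇒surjective : ∀ {n r} {f : Fin n → Fin r} → Injective _≡_ _≡_ f → r ≤ n →
                       ∀ y → ∃ λ x → f x ≡ y
injective⇒surjective {r = suc r} {f} f-injective r≤n y with any? (λ x → f x ≟ y)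
... | yes hit = hit
... | no miss = contradiction (injective⇒≤ missing-injective) (<⇒≱ r≤n)
  where
  y∉f : ∀ x → y ≢ f x
  y∉f x y≡fx = miss (x , sym y≡fx)
  missing-injective : Injective _≡_ _≡_ (λ x → punchOut (y∉f x))
  missing-injective = f-injective ∘ punchOut-injective (y∉f _) (y∉f _)

-- Both injections are bijections, since r ≤ n.
injections-differ-by-permutation :
  ∀ {n r} {f g : Fin n → Fin r} → Injective _≡_ _≡_ f → Injective _≡_ _≡_ g → r ≤ n →
  Σ (Permutation n n) λ π → ∀ i → g (π ⟨$⟩ʳ i) ≡ f i
injections-differ-by-permutation {f = f} {g} f-injective g-injective r≤n =
  permutation to from to∘from from∘to , proj₂ ∘ g-onto ∘ f
  where
  f-onto : ∀ y → ∃ λ i → f i ≡ y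
  f-onto = injective⇒surjective f-injective r≤n
  g-onto : ∀ y → ∃ λ i → g i ≡ y
  g-onto = injective⇒surjective g-injective r≤n
  to from : Fin _ → Fin _
  to = proj₁ ∘ g-onto ∘ f
  from = proj₁ ∘ f-onto ∘ g
  from∘to : ∀ i → from (to i) ≡ i
  from∘to i = f-injective (trans (proj₂ (f-onto _)) (proj₂ (g-onto _)))
  to∘from : ∀ i → to (from i) ≡ i
  to∘from i = g-injective (trans (proj₂ (g-onto _)) (proj₂ (f-onto _)))

K-permuteˡ : ∀ {a b} → Permutation a a → Automorphism (K a b)
K-permuteˡ {a} {b} π = record { perm = π ⊎-↔ ↔-refl ; preserves = preserves-adj }
  where
  preserves-adj : ∀ x y → K-adj a b (map (π ⟨$⟩ʳ_) id x) (map (π ⟨$⟩ʳ_) id y) ≡ K-adj a b x y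
  preserves-adj (inj₁ _) (inj₁ _) = refl
  preserves-adj (inj₁ _) (inj₂ _) = refl
  preserves-adj (inj₂ _) (inj₁ _) = refl
  preserves-adj (inj₂ _) (inj₂ _) = refl

module _ {V W : Set} {G : Graph V} {H : Graph W} where

  +ᴳ-extendˡ : Automorphism G → Automorphism (G +ᴳ H)
  +ᴳ-extendˡ σ = record { perm = perm σ ⊎-↔ ↔-refl ; preserves = preserves-adj }
    where
    preserves-adj : ∀ x y → join-adj G H (map (act σ) id x) (map (act σ) id y) ≡ join-adj G H x y
    preserves-adj (inj₁ x) (inj₁ y) = preserves σ x y
    preserves-adj (inj₁ _) (inj₂ _) = refl
    preserves-adj (inj₂ _) (inj₁ _) = refl
    preserves-adj (inj₂ _) (inj₂ _) = refl

  +ᴳ-extendʳ : Automorphism H → Automorphism (G +ᴳ H)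
  +ᴳ-extendʳ σ = record { perm = ↔-refl ⊎-↔ perm σ ; preserves = preserves-adj }
    where
    preserves-adj : ∀ x y → join-adj G H (map id (act σ) x) (map id (act σ) y) ≡ join-adj G H x y
    preserves-adj (inj₁ _) (inj₁ _) = refl
    preserves-adj (inj₁ _) (inj₂ _) = refl
    preserves-adj (inj₂ _) (inj₁ _) = refl
    preserves-adj (inj₂ x) (inj₂ y) = preserves σ x y

  distinguishing-+ᴳˡ : ∀ {r ℓ} → IsDistinguishing (G +ᴳ H) r ℓ → IsDistinguishing G r (ℓ ∘ inj₁)
  distinguishing-+ᴳˡ {ℓ = ℓ} distinguishing σ σ-preserves-ℓ x =
    inj₁-injective (distinguishing (+ᴳ-extendˡ σ) preserves-ℓ (inj₁ x))
    where
    preserves-ℓ : ∀ v → ℓ (act (+ᴳ-extendˡ σ) v) ≡ ℓ v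
    preserves-ℓ (inj₁ x) = σ-preserves-ℓ x
    preserves-ℓ (inj₂ _) = refl

  distinguishing-+ᴳʳ : ∀ {r ℓ} → IsDistinguishing (G +ᴳ H) r ℓ → IsDistinguishing H r (ℓ ∘ inj₂)
  distinguishing-+ᴳʳ {ℓ = ℓ} distinguishing σ σ-preserves-ℓ y =
    inj₂-injective (distinguishing (+ᴳ-extendʳ σ) preserves-ℓ (inj₂ y))
    where
    preserves-ℓ : ∀ v → ℓ (act (+ᴳ-extendʳ σ) v) ≡ ℓ v
    preserves-ℓ (inj₁ _) = refl
    preserves-ℓ (inj₂ y) = σ-preserves-ℓ y

K-distinguishing⇒injectiveˡ : ∀ {a b r ℓ} → IsDistinguishing (K a b) r ℓ → Injective _≡_ _≡_ (ℓ ∘ inj₁)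
K-distinguishing⇒injectiveˡ {ℓ = ℓ} distinguishing {i} {j} ℓi≡ℓj =
  trans (sym (inj₁-injective (distinguishing τ preserves-ℓ (inj₁ i)))) (transpose-matchˡ i j)
  where
  τ : Automorphism (K _ _)
  τ = K-permuteˡ (transpose i j)
  preserves-ℓ : ∀ v → ℓ (act τ v) ≡ ℓ v
  preserves-ℓ (inj₁ k) = transpose-respects (ℓ ∘ inj₁) ℓi≡ℓj k
  preserves-ℓ (inj₂ _) = refl

record CompleteMultipartite {V P : Set} (G : Graph V) (part : V → P) : Set where
  field
    nonadjacent⇒samePart : ∀ x y → adj G x y ≡ false → part x ≡ part y
    samePart⇒nonadjacent : ∀ x y → part x ≡ part y → adj G x y ≡ false
open CompleteMultipartite

side : {X Y : Set} → X ⊎ Y → ⊤ ⊎ ⊤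
side = map (const tt) (const tt)

K-multipartite : ∀ {a b} → CompleteMultipartite (K a b) side
K-multipartite = record { nonadjacent⇒samePart = nonadj⇒same ; samePart⇒nonadjacent = same⇒nonadj }
  where
  nonadj⇒same : ∀ x y → K-adj _ _ x y ≡ false → side x ≡ side y
  nonadj⇒same (inj₁ _) (inj₁ _) _ = refl
  nonadj⇒same (inj₁ _) (inj₂ _) ()
  nonadj⇒same (inj₂ _) (inj₁ _) ()
  nonadj⇒same (inj₂ _) (inj₂ _) _ = refl
  same⇒nonadj : ∀ x y → side x ≡ side y → K-adj _ _ x y ≡ false
  same⇒nonadj (inj₁ _) (inj₁ _) _ = refl
  same⇒nonadj (inj₁ _) (inj₂ _) ()
  same⇒nonadj (inj₂ _) (inj₁ _) ()
  same⇒nonadj (inj₂ _) (inj₂ _) _ = refl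

+ᴳ-multipartite : {V W P Q : Set} {G : Graph V} {H : Graph W} {p : V → P} {q : W → Q} →
                  CompleteMultipartite G p → CompleteMultipartite H q →
                  CompleteMultipartite (G +ᴳ H) (map p q)
+ᴳ-multipartite {G = G} {H} {p} {q} MG MH =
  record { nonadjacent⇒samePart = nonadj⇒same ; samePart⇒nonadjacent = same⇒nonadj }
  where
  nonadj⇒same : ∀ x y → join-adj G H x y ≡ false → map p q x ≡ map p q y
  nonadj⇒same (inj₁ x) (inj₁ y) e = cong inj₁ (nonadjacent⇒samePart MG x y e)
  nonadj⇒same (inj₁ _) (inj₂ _) ()
  nonadj⇒same (inj₂ _) (inj₁ _) ()
  nonadj⇒same (inj₂ x) (inj₂ y) e = cong inj₂ (nonadjacent⇒samePart MH x y e)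
  same⇒nonadj : ∀ x y → map p q x ≡ map p q y → join-adj G H x y ≡ false
  same⇒nonadj (inj₁ x) (inj₁ y) e = samePart⇒nonadjacent MG x y (inj₁-injective e)
  same⇒nonadj (inj₁ _) (inj₂ _) ()
  same⇒nonadj (inj₂ _) (inj₁ _) ()
  same⇒nonadj (inj₂ x) (inj₂ y) e = samePart⇒nonadjacent MH x y (inj₂-injective e)

≡false⇔⇒≡ : {a b : Bool} → (a ≡ false → b ≡ false) → (b ≡ false → a ≡ false) → a ≡ b
≡false⇔⇒≡ {false} {false} _ _ = refl
≡false⇔⇒≡ {false} {true}  a⇒b _ = sym (a⇒b refl)
≡false⇔⇒≡ {true}  {false} _ b⇒a = b⇒a refl
≡false⇔⇒≡ {true}  {true}  _ _ = refl

module _ {V P : Set} {G : Graph V} {part : V → P} (M : CompleteMultipartite G part) where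

  part-permuting⇒automorphism : (π : V ↔ V) (g : P ↔ P) →
    (∀ v → part (Inverse.to π v) ≡ Inverse.to g (part v)) → Automorphism G
  part-permuting⇒automorphism π g commutes = record { perm = π ; preserves = preserves-adj }
    where
    to : V → V
    to = Inverse.to π
    same-after⇒same : ∀ {x y} → part (to x) ≡ part (to y) → part x ≡ part y
    same-after⇒same {x} {y} e =
      Injection.injective (↔⇒↣ g) (trans (sym (commutes x)) (trans e (commutes y)))
    same⇒same-after : ∀ {x y} → part x ≡ part y → part (to x) ≡ part (to y)
    same⇒same-after {x} {y} e = trans (commutes x) (trans (cong (Inverse.to g) e) (sym (commutes y)))
    preserves-adj : ∀ x y → adj G (to x) (to y) ≡ adj G x y
    preserves-adj x y = ≡false⇔⇒≡
      (samePart⇒nonadjacent M x y ∘ same-after⇒same ∘ nonadjacent⇒samePart M (to x) (to y))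
      (samePart⇒nonadjacent M (to x) (to y) ∘ same⇒same-after ∘ nonadjacent⇒samePart M x y)

  module _ (σ : Automorphism G) where

    automorphism-preserves-samePart : ∀ {x y} → part x ≡ part y → part (act σ x) ≡ part (act σ y)
    automorphism-preserves-samePart {x} {y} e =
      nonadjacent⇒samePart M _ _ (trans (preserves σ x y) (samePart⇒nonadjacent M x y e))

    automorphism-reflects-samePart : ∀ {x y} → part (act σ x) ≡ part (act σ y) → part x ≡ part y
    automorphism-reflects-samePart {x} {y} e =
      nonadjacent⇒samePart M x y (trans (sym (preserves σ x y)) (samePart⇒nonadjacent M _ _ e))

InjectiveOnParts : {V P X : Set} → (V → P) → (V → X) → Set
InjectiveOnParts part f = ∀ {x y} → part x ≡ part y → f x ≡ f y → x ≡ y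

injective⇒injectiveOnParts : {V X : Set} {f : V → X} → Injective _≡_ _≡_ f → InjectiveOnParts (const tt) f
injective⇒injectiveOnParts f-injective _ = f-injective

[,]-injectiveOnParts : {V W P Q X : Set} {p : V → P} {q : W → Q} {f : V → X} {g : W → X} →
  InjectiveOnParts p f → InjectiveOnParts q g → InjectiveOnParts (map p q) [ f , g ]
[,]-injectiveOnParts f-inj g-inj {inj₁ x} {inj₁ y} e fx≡fy = cong inj₁ (f-inj (inj₁-injective e) fx≡fy)
[,]-injectiveOnParts f-inj g-inj {inj₁ _} {inj₂ _} ()
[,]-injectiveOnParts f-inj g-inj {inj₂ _} {inj₁ _} ()
[,]-injectiveOnParts f-inj g-inj {inj₂ x} {inj₂ y} e gx≡gy = cong inj₂ (g-inj (inj₂-injective e) gx≡gy)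

pattern A i = inj₁ (inj₁ i)
pattern B j = inj₁ (inj₂ j)
pattern C i = inj₂ (inj₁ i)
pattern D j = inj₂ (inj₂ j)

Part : Set
Part = (⊤ ⊎ ⊤) ⊎ (⊤ ⊎ ⊤)

exchange-AC : Part ↔ Part
exchange-AC = mk↔ₛ′ swap swap involutive involutive
  where
  swap : Part → Part
  swap (A t) = C t
  swap (C t) = A t
  swap p = p
  involutive : ∀ p → swap (swap p) ≡ p
  involutive (A _) = refl
  involutive (B _) = refl
  involutive (C _) = refl
  involutive (D _) = refl

module TwoBipartite (n m m′ : ℕ) where

  V : Set
  V = (Fin n ⊎ Fin m) ⊎ (Fin n ⊎ Fin m′)

  Γ : Graph V
  Γ = K n m +ᴳ K n m′

  part : V → Part
  part = map side side

  Γ-multipartite : CompleteMultipartite Γ part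
  Γ-multipartite = +ᴳ-multipartite K-multipartite K-multipartite

  exchange : Permutation n n → Automorphism Γ
  exchange π = part-permuting⇒automorphism Γ-multipartite
    (mk↔ₛ′ swap swap involutive involutive) exchange-AC commutes
    where
    swap : V → V
    swap (A i) = C (π ⟨$⟩ʳ i)
    swap (C i) = A (π ⟨$⟩ˡ i)
    swap v = v
    involutive : ∀ v → swap (swap v) ≡ v
    involutive (A i) = cong A (inverseˡ π)
    involutive (B _) = refl
    involutive (C i) = cong C (inverseʳ π)
    involutive (D _) = refl
    commutes : ∀ v → part (swap v) ≡ Inverse.to exchange-AC (part v)
    commutes (A _) = refl
    commutes (B _) = refl
    commutes (C _) = refl
    commutes (D _) = refl

  no-distinguishing-labelling-with-≤n-labels :
    ∀ {r ℓ} → IsDistinguishing Γ r ℓ → Fin n → ¬ (r ≤ n)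
  no-distinguishing-labelling-with-≤n-labels {ℓ = ℓ} distinguishing i₀ r≤n =
    contradiction (distinguishing (exchange π) preserves-ℓ (A i₀)) λ ()
    where
    ℓA-injective : Injective _≡_ _≡_ (ℓ ∘ A)
    ℓA-injective = K-distinguishing⇒injectiveˡ (distinguishing-+ᴳˡ distinguishing)
    ℓC-injective : Injective _≡_ _≡_ (ℓ ∘ C)
    ℓC-injective = K-distinguishing⇒injectiveˡ (distinguishing-+ᴳʳ distinguishing)
    related : Σ (Permutation n n) λ π → ∀ i → ℓ (C (π ⟨$⟩ʳ i)) ≡ ℓ (A i)
    related = injections-differ-by-permutation ℓA-injective ℓC-injective r≤n
    π : Permutation n n
    π = proj₁ related
    preserves-ℓ : ∀ v → ℓ (act (exchange π) v) ≡ ℓ v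
    preserves-ℓ (A i) = proj₂ related i
    preserves-ℓ (B _) = refl
    preserves-ℓ (C i) = trans (sym (proj₂ related _)) (cong (ℓ ∘ C) (inverseʳ π))
    preserves-ℓ (D _) = refl

-- Here the parts have sizes n + 1, k + 1, n + 1, k′ + 1.
module Labelling (n k k′ : ℕ) (k<n : k < n) (k′<n : k′ < n) (k≢k′ : k ≢ k′) where

  open TwoBipartite (suc n) (suc k) (suc k′)

  rank : V → ℕ
  rank = [ [ toℕ , suc ∘ toℕ ] , [ suc ∘ toℕ , suc ∘ toℕ ] ]

  rank-injectiveOnParts : InjectiveOnParts part rank
  rank-injectiveOnParts =
    [,]-injectiveOnParts ([,]-injectiveOnParts toℕ-injectiveOnParts suc-toℕ-injectiveOnParts)
                         ([,]-injectiveOnParts suc-toℕ-injectiveOnParts suc-toℕ-injectiveOnParts)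
    where
    toℕ-injectiveOnParts : ∀ {l} → InjectiveOnParts (const tt) (toℕ {l})
    toℕ-injectiveOnParts = injective⇒injectiveOnParts toℕ-injective
    suc-toℕ-injectiveOnParts : ∀ {l} → InjectiveOnParts (const tt) (suc ∘ toℕ {l})
    suc-toℕ-injectiveOnParts = injective⇒injectiveOnParts (toℕ-injective ∘ suc-injective)

  rank≤ : ∀ v → rank v ≤ suc n
  rank≤ (A i) = <⇒≤ (toℕ<n i)
  rank≤ (B j) = s≤s (<⇒≤ (<-≤-trans (toℕ<n j) k<n))
  rank≤ (C i) = toℕ<n i
  rank≤ (D j) = s≤s (<⇒≤ (<-≤-trans (toℕ<n j) k′<n))

  label : V → Fin (suc (suc n))
  label v = fromℕ< (s≤s (rank≤ v))

  rank-zero-unique : ∀ v → rank v ≡ 0 → v ≡ A zero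
  rank-zero-unique (A zero) _ = refl
  rank-zero-unique (C _) ()
  rank-zero-unique (D _) ()

  rank-top-unique : ∀ v → rank v ≡ suc n → v ≡ C (fromℕ n)
  rank-top-unique (A i) e = ⊥-elim (<-irrefl e (toℕ<n i))
  rank-top-unique (B j) e = ⊥-elim (<-irrefl (suc-injective e) (<-≤-trans (toℕ<n j) k<n))
  rank-top-unique (C i) e = cong C (toℕ-injective (trans (suc-injective e) (sym (toℕ-fromℕ n))))
  rank-top-unique (D j) e = ⊥-elim (<-irrefl (suc-injective e) (<-≤-trans (toℕ<n j) k′<n))

  partB partD : Part
  partB = B tt
  partD = D tt

  rank≤-in-B : ∀ v → part v ≡ partB → rank v ≤ suc k
  rank≤-in-B (B j) _ = toℕ<n j

  rank≤-in-D : ∀ v → part v ≡ partD → rank v ≤ suc k′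
  rank≤-in-D (D j) _ = toℕ<n j

  topB topD : V
  topB = B (fromℕ k)
  topD = D (fromℕ k′)

  module LabelPreserving (σ : Automorphism Γ) (preserves-label : ∀ v → label (act σ v) ≡ label v) where

    open ≡-Reasoning
    σ̂ : V → V
    σ̂ = act σ
    preserves-samePart : ∀ {x y} → part x ≡ part y → part (σ̂ x) ≡ part (σ̂ y)
    preserves-samePart = automorphism-preserves-samePart Γ-multipartite σ
    reflects-samePart : ∀ {x y} → part (σ̂ x) ≡ part (σ̂ y) → part x ≡ part y
    reflects-samePart = automorphism-reflects-samePart Γ-multipartite σ

    preserves-rank : ∀ v → rank (σ̂ v) ≡ rank v
    preserves-rank v = begin
      rank (σ̂ v)            ≡⟨ sym (toℕ-fromℕ< _) ⟩
      toℕ (label (σ̂ v))     ≡⟨ cong toℕ (preserves-label v) ⟩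
      toℕ (label v)          ≡⟨ toℕ-fromℕ< _ ⟩
      rank v                 ∎

    fixes-part : ∀ {a v} → part (σ̂ a) ≡ part a → part v ≡ part a → σ̂ v ≡ v
    fixes-part {a} {v} σa∈a v∈a = rank-injectiveOnParts same-part (preserves-rank v)
      where
      same-part : part (σ̂ v) ≡ part v
      same-part = trans (preserves-samePart v∈a) (trans σa∈a (sym v∈a))

    fixes-A : σ̂ (A zero) ≡ A zero
    fixes-A = rank-zero-unique _ (preserves-rank (A zero))

    fixes-C : σ̂ (C (fromℕ n)) ≡ C (fromℕ n)
    fixes-C = rank-top-unique _ (trans (preserves-rank (C (fromℕ n))) (cong suc (toℕ-fromℕ n)))

    into-part-of-fixed : ∀ {a v} → σ̂ a ≡ a → part (σ̂ v) ≡ part a → part v ≡ part a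
    into-part-of-fixed σa≡a e = reflects-samePart (trans e (cong part (sym σa≡a)))

    rank-bound-transfers : ∀ {v p l} → part (σ̂ v) ≡ p → (∀ w → part w ≡ p → rank w ≤ l) → rank v ≤ l
    rank-bound-transfers {v} e bound = subst (_≤ _) (preserves-rank v) (bound (σ̂ v) e)

    B-or-D : ∀ v → part v ≢ part (A zero) → part v ≢ part (C zero) →
             part (σ̂ v) ≡ partB ⊎ part (σ̂ v) ≡ partD
    B-or-D v v∉A v∉C with part (σ̂ v) in e
    ... | A _ = contradiction (into-part-of-fixed fixes-A e) v∉A
    ... | B _ = inj₁ refl
    ... | C _ = contradiction (into-part-of-fixed fixes-C e) v∉C
    ... | D _ = inj₂ refl

    -- Exchanging B and D would carry the largest rank of each into the other part.
    B-and-D-stable : part (σ̂ topB) ≡ partB × part (σ̂ topD) ≡ partD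
    B-and-D-stable with B-or-D topB (λ ()) (λ ()) | B-or-D topD (λ ()) (λ ())
    ... | inj₁ b∈B | inj₂ d∈D = b∈B , d∈D
    ... | inj₁ b∈B | inj₁ d∈B = contradiction (reflects-samePart (trans b∈B (sym d∈B))) λ ()
    ... | inj₂ b∈D | inj₂ d∈D = contradiction (reflects-samePart (trans b∈D (sym d∈D))) λ ()
    ... | inj₂ b∈D | inj₁ d∈B =
      contradiction (≤-antisym (top≤ k (rank-bound-transfers b∈D rank≤-in-D))
                               (top≤ k′ (rank-bound-transfers d∈B rank≤-in-B))) k≢k′
      where
      top≤ : ∀ l {l′} → suc (toℕ (fromℕ l)) ≤ suc l′ → l ≤ l′
      top≤ l = subst (_≤ _) (toℕ-fromℕ l) ∘ s≤s⁻¹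

    fixed : ∀ v → σ̂ v ≡ v
    fixed (A _) = fixes-part (cong part fixes-A) refl
    fixed (B _) = fixes-part (proj₁ B-and-D-stable) refl
    fixed (C _) = fixes-part (cong part fixes-C) refl
    fixed (D _) = fixes-part (proj₂ B-and-D-stable) refl

  label-distinguishing : IsDistinguishing Γ (suc (suc n)) label
  label-distinguishing = LabelPreserving.fixed

corollary2p7 : (n m m′ : ℕ) → 0 < n → 0 < m → 0 < m′ → n > m → n > m′ → m ≢ m′ →
    DistinguishingNumber (K n m +ᴳ K n m′) (suc n)
corollary2p7 (suc n) (suc k) (suc k′) (s≤s z≤n) (s≤s z≤n) (s≤s z≤n) (s≤s k<n) (s≤s k′<n) m≢m′ =
  (label , label-distinguishing) ,
  λ _ (_ , ℓ-distinguishing) → ≰⇒> (no-distinguishing-labelling-with-≤n-labels ℓ-distinguishing zero)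
  where
  open TwoBipartite (suc n) (suc k) (suc k′)
  open Labelling n k k′ k<n k′<n (m≢m′ ∘ cong suc)
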